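{- Let $k,l$ be positive integers and write $k=k_1\cdots k_r$ and $l=l_1\cdots l_s$ as products of positive integers such that for all $1\leq u\leq r$ and $1\leq v\leq s$, either $k_u=l_v$ or $\gcd(k_u,l_v)=1$. Set $K_u=\prod_{x=1}^{u-1}k_x$ and $L_v=\prod_{y=1}^{v-1}l_y$. Then there is a bijection $\Psi_{k,l}$ from $\mathcal{R}_{k,l}$ to the product set $\prod_{u=1}^r\prod_{v=1}^s \mathcal{R}_{k_u,l_v}$ such that, whenever $\Psi_{k,l}(\lambda)=(\lambda_{u,v})_{u,v}$, $$|\lambda| = \sum_{u=1}^r \sum_{v=1}^s K_uL_v\, |\lambda_{u,v}|.$$
   Context: A partition is written by its frequency sequence $1^{f_1}2^{f_2}\cdots$, where $f_i$ is the number of occurrences of the part $i$; its weight is $|\lambda|=\sum_i i f_i$. For positive integers $a,b$, an $a,b$-regular partition is a partition with no part divisible by $a$ and in which every part occurs fewer than $b$ times (i.e. $f_{ia}=0$ and $f_i<b$ for all $i\geq1$), and $\mathcal{R}_{a,b}$ denotes the set of $a,b$-regular partitions. An empty product equals $1$. -}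

module Defs where

open import Data.Nat using (ℕ; zero; suc; _+_; _*_; _<_)
open import Data.Nat.Divisibility using (_∣?_)
open import Data.Bool using (if_then_else_)
open import Data.List using (List; []; _∷_)
open import Data.List.Relation.Unary.All using (All; []; _∷_)
open import Data.Product using (Σ; _×_; proj₁)
open import Data.Unit using (⊤)
open import Relation.Nullary using (does)
open import Relation.Binary.PropositionalEquality using (_≡_)

-- A partition is encoded by its (finite) frequency sequence
-- fs = [f₁, f₂, …, f_m], where f_i is the multiplicity of the part i,
-- normalised so that the last entry (if any) is nonzero.  This makes the
-- encoding of a partition unique; the empty list is the empty partition.
NoTrailingZero : List ℕ → Set
NoTrailingZero []           = ⊤
NoTrailingZero (f ∷ [])     = 0 < f
NoTrailingZero (f ∷ g ∷ fs) = NoTrailingZero (g ∷ fs)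

weightFrom : ℕ → List ℕ → ℕ
weightFrom i []       = 0
weightFrom i (f ∷ fs) = i * f + weightFrom (suc i) fs

weight : List ℕ → ℕ
weight fs = weightFrom 1 fs

-- (a,b)-regularity condition at part i with multiplicity f:
-- if a ∣ i then f_i = 0, otherwise f_i < b.
-- (When a ∣ i, f_i = 0 already implies f_i < b since b is positive.)
RegAt : ℕ → ℕ → ℕ → ℕ → Set
RegAt a b i f = if does (a ∣? i) then f ≡ 0 else f < b

RegFrom : ℕ → ℕ → ℕ → List ℕ → Set
RegFrom a b i []       = ⊤
RegFrom a b i (f ∷ fs) = RegAt a b i f × RegFrom a b (suc i) fs

RegPart : ℕ → ℕ → Set
RegPart a b = Σ (List ℕ) (λ fs → NoTrailingZero fs × RegFrom a b 1 fs)

Grid : List ℕ → List ℕ → Set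
Grid ks ls = All (λ a → All (λ b → RegPart a b) ls) ks

rowWeight : (K L : ℕ) {a : ℕ} (ls : List ℕ) → All (λ b → RegPart a b) ls → ℕ
rowWeight K L []       []       = 0
rowWeight K L (b ∷ ls) (p ∷ ps) = K * L * weight (proj₁ p) + rowWeight K (L * b) ls ps

gridWeightFrom : (K : ℕ) (ks ls : List ℕ) → Grid ks ls → ℕ
gridWeightFrom K []       ls []           = 0
gridWeightFrom K (a ∷ ks) ls (row ∷ rows) = rowWeight K 1 ls row + gridWeightFrom (K * a) ks ls rows

gridWeight : (ks ls : List ℕ) → Grid ks ls → ℕ
gridWeight ks ls g = gridWeightFrom 1 ks ls g

-- Two weight-preserving splittings do all the work. Writing a multiplicity f < b c in base b as
-- f = x + y b splits λ ∈ 𝓡_{a,bc} into μ ∈ 𝓡_{a,b} and ν ∈ 𝓡_{a,c} with |λ| = |μ| + b |ν|. Separating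
-- the parts of λ ∈ 𝓡_{ab,l} divisible by a from the others, and dividing the former by a, splits λ
-- into μ ∈ 𝓡_{a,l} and ν ∈ 𝓡_{b,l} with |λ| = |μ| + a |ν|. Peeling k₁, k₂, … off k with the second
-- splitting and then l₁, l₂, … off l with the first yields the grid, the scale factors accumulating
-- to K_u L_v. Since partitions are frequency lists without trailing zeros, the inverse laws are
-- proved coefficientwise and transported back along normalisation.
module Submission where

open import Defs
open import Data.Empty using (⊥-elim)
open import Data.List using (List; []; _∷_; map)
open import Data.List.Relation.Unary.All using (All; []; _∷_)
import Data.List.Relation.Unary.All as All
open import Data.Nat using (ℕ; zero; suc; _+_; _*_; _≤_; _<_; z≤n; s≤s; NonZero; >-nonZero; >-nonZero⁻¹)
open import Data.Nat.DivMod
  using (_%_; _/_; m%n<n; 0/n≡0; m<n*o⇒m/o<n; m≡m%n+[m/n]*n; [m+kn]%n≡m%n; m<n⇒m%n≡m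
        ; +-distrib-/-∣ʳ; m<n⇒m/n≡0; m*n/n≡m)
open import Data.Nat.Divisibility
  using (_∣_; _∣?_; divides; 1∣_; ∣⇒≤; ∣m+n∣m⇒∣n; m∣m*n; ∣-trans; *-monoʳ-∣; *-cancelˡ-∣)
open import Data.Nat.GCD using (gcd)
open import Data.Nat.ListAction using (product)
open import Data.Nat.ListAction.Properties using (product≢0)
open import Data.Nat.Properties
open import Algebra.Properties.CommutativeSemigroup +-commutativeSemigroup
  using () renaming (interchange to +-interchange)
open import Data.Product using (Σ; _×_; _,_; proj₁; proj₂)
open import Data.Sum using (_⊎_)
open import Data.Unit using (tt)
open import Function.Bundles using (_⤖_; Bijection; _↔_; mk↔ₛ′; Inverse)
open import Function.Properties.Inverse using (↔-refl; ↔⇒⤖)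
open import Level using (0ℓ)
open import Relation.Binary.Bundles using (Setoid)
import Relation.Binary.Reasoning.Setoid
open import Relation.Binary.PropositionalEquality
  using (_≡_; refl; sym; trans; cong; cong₂; subst; module ≡-Reasoning)
open import Relation.Nullary using (yes; no; ¬_)

-- coeff fs p is the multiplicity of the part 1 + p.
coeff : List ℕ → ℕ → ℕ
coeff []       p       = 0
coeff (f ∷ fs) zero    = f
coeff (f ∷ fs) (suc p) = coeff fs p

infix 4 _≋_
record _≋_ (xs ys : List ℕ) : Set where
  constructor coeffwise
  field coeff-≡ : ∀ p → coeff xs p ≡ coeff ys p
open _≋_

≋-refl : ∀ {xs} → xs ≋ xs
≋-refl = coeffwise λ _ → refl

≋-sym : ∀ {xs ys} → xs ≋ ys → ys ≋ xs
≋-sym e = coeffwise λ p → sym (coeff-≡ e p)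

≋-trans : ∀ {xs ys zs} → xs ≋ ys → ys ≋ zs → xs ≋ zs
≋-trans e e′ = coeffwise λ p → trans (coeff-≡ e p) (coeff-≡ e′ p)

≋-setoid : Setoid 0ℓ 0ℓ
≋-setoid = record
  { Carrier = List ℕ ; _≈_ = _≋_
  ; isEquivalence = record { refl = ≋-refl ; sym = ≋-sym ; trans = ≋-trans } }

module ≋-Reasoning = Relation.Binary.Reasoning.Setoid ≋-setoid

∷-≋ : ∀ {x y xs ys} → x ≡ y → xs ≋ ys → x ∷ xs ≋ y ∷ ys
∷-≋ x≡y e = coeffwise λ { zero → x≡y ; (suc p) → coeff-≡ e p }

≋-tail : ∀ {x y xs ys} → x ∷ xs ≋ y ∷ ys → xs ≋ ys
≋-tail e = coeffwise λ p → coeff-≡ e (suc p)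

infixr 5 _∷₀_
_∷₀_ : ℕ → List ℕ → List ℕ
zero  ∷₀ [] = []
x     ∷₀ xs = x ∷ xs

normalise : List ℕ → List ℕ
normalise []       = []
normalise (x ∷ xs) = x ∷₀ normalise xs

∷₀-≋ : ∀ x xs → x ∷₀ xs ≋ x ∷ xs
∷₀-≋ zero    []      = coeffwise λ { zero → refl ; (suc _) → refl }
∷₀-≋ zero    (_ ∷ _) = ≋-refl
∷₀-≋ (suc x) xs      = ≋-refl

normalise-≋ : ∀ xs → normalise xs ≋ xs
normalise-≋ []       = ≋-refl
normalise-≋ (x ∷ xs) = ≋-trans (∷₀-≋ x (normalise xs)) (∷-≋ refl (normalise-≋ xs))

∷₀-canonical : ∀ x {xs} → NoTrailingZero xs → NoTrailingZero (x ∷₀ xs)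
∷₀-canonical zero    {[]}    _ = tt
∷₀-canonical zero    {_ ∷ _} c = c
∷₀-canonical (suc x) {[]}    _ = s≤s z≤n
∷₀-canonical (suc x) {_ ∷ _} c = c

normalise-canonical : ∀ xs → NoTrailingZero (normalise xs)
normalise-canonical []       = tt
normalise-canonical (x ∷ xs) = ∷₀-canonical x (normalise-canonical xs)

canonical-tail : ∀ x xs → NoTrailingZero (x ∷ xs) → NoTrailingZero xs
canonical-tail _ []      _ = tt
canonical-tail _ (_ ∷ _) c = c

canonical-nonvanishing : ∀ x xs → NoTrailingZero (x ∷ xs) → ¬ ([] ≋ x ∷ xs)
canonical-nonvanishing _ []       0<x e = <-irrefl (coeff-≡ e 0) 0<x
canonical-nonvanishing _ (y ∷ ys) c   e = canonical-nonvanishing y ys c (coeffwise λ p → coeff-≡ e (suc p))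

canonical-≋⇒≡ : ∀ xs ys → NoTrailingZero xs → NoTrailingZero ys → xs ≋ ys → xs ≡ ys
canonical-≋⇒≡ []       []       _  _  _ = refl
canonical-≋⇒≡ []       (y ∷ ys) _  cy e = ⊥-elim (canonical-nonvanishing y ys cy e)
canonical-≋⇒≡ (x ∷ xs) []       cx _  e = ⊥-elim (canonical-nonvanishing x xs cx (≋-sym e))
canonical-≋⇒≡ (x ∷ xs) (y ∷ ys) cx cy e =
  cong₂ _∷_ (coeff-≡ e 0) (canonical-≋⇒≡ xs ys (canonical-tail x xs cx) (canonical-tail y ys cy) (≋-tail e))

normalise-cong : ∀ {xs ys} → xs ≋ ys → normalise xs ≡ normalise ys
normalise-cong {xs} {ys} e = canonical-≋⇒≡ _ _ (normalise-canonical xs) (normalise-canonical ys)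
  (≋-trans (normalise-≋ xs) (≋-trans e (≋-sym (normalise-≋ ys))))

Vanishing : List ℕ → Set
Vanishing = All (_≡ 0)

vanishing-≋ : ∀ {zs} → Vanishing zs → zs ≋ []
vanishing-≋ []          = ≋-refl
vanishing-≋ (z≡0 ∷ zs≡0) = ≋-trans (∷-≋ z≡0 (vanishing-≋ zs≡0)) (≋-sym (∷₀-≋ 0 []))

coeff-map : ∀ g → g 0 ≡ 0 → ∀ xs p → coeff (map g xs) p ≡ g (coeff xs p)
coeff-map g g0≡0 []       p       = sym g0≡0
coeff-map g g0≡0 (x ∷ xs) zero    = refl
coeff-map g g0≡0 (x ∷ xs) (suc p) = coeff-map g g0≡0 xs p

map-≋ : ∀ g → g 0 ≡ 0 → ∀ {xs ys} → xs ≋ ys → map g xs ≋ map g ys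
map-≋ g g0≡0 {xs} {ys} e = coeffwise λ p →
  trans (coeff-map g g0≡0 xs p) (trans (cong g (coeff-≡ e p)) (sym (coeff-map g g0≡0 ys p)))

infixl 6 _⊕_
_⊕_ : List ℕ → List ℕ → List ℕ
[]       ⊕ ys       = ys
(x ∷ xs) ⊕ []       = x ∷ xs
(x ∷ xs) ⊕ (y ∷ ys) = x + y ∷ xs ⊕ ys

coeff-⊕ : ∀ xs ys p → coeff (xs ⊕ ys) p ≡ coeff xs p + coeff ys p
coeff-⊕ []       ys       p       = refl
coeff-⊕ (x ∷ xs) []       p       = sym (+-identityʳ _)
coeff-⊕ (x ∷ xs) (y ∷ ys) zero    = refl
coeff-⊕ (x ∷ xs) (y ∷ ys) (suc p) = coeff-⊕ xs ys p

⊕-cong : ∀ {xs xs′ ys ys′} → xs ≋ xs′ → ys ≋ ys′ → xs ⊕ ys ≋ xs′ ⊕ ys′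
⊕-cong {xs} {xs′} {ys} {ys′} e e′ = coeffwise λ p → begin
  coeff (xs ⊕ ys) p           ≡⟨ coeff-⊕ xs ys p ⟩
  coeff xs p + coeff ys p     ≡⟨ cong₂ _+_ (coeff-≡ e p) (coeff-≡ e′ p) ⟩
  coeff xs′ p + coeff ys′ p   ≡⟨ coeff-⊕ xs′ ys′ p ⟨
  coeff (xs′ ⊕ ys′) p         ∎
  where open ≡-Reasoning

⊕-identityʳ : ∀ xs → xs ⊕ [] ≡ xs
⊕-identityʳ []      = refl
⊕-identityʳ (_ ∷ _) = refl

weightFrom-∷₀ : ∀ i x xs → weightFrom i (x ∷₀ xs) ≡ weightFrom i (x ∷ xs)
weightFrom-∷₀ i zero    []      = sym (trans (+-identityʳ (i * 0)) (*-zeroʳ i))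
weightFrom-∷₀ i zero    (_ ∷ _) = refl
weightFrom-∷₀ i (suc x) xs      = refl

weightFrom-normalise : ∀ i xs → weightFrom i (normalise xs) ≡ weightFrom i xs
weightFrom-normalise i []       = refl
weightFrom-normalise i (x ∷ xs) =
  trans (weightFrom-∷₀ i x (normalise xs)) (cong (i * x +_) (weightFrom-normalise (suc i) xs))

weightFrom-cong : ∀ i {xs ys} → xs ≋ ys → weightFrom i xs ≡ weightFrom i ys
weightFrom-cong i {xs} {ys} e = begin
  weightFrom i xs               ≡⟨ weightFrom-normalise i xs ⟨
  weightFrom i (normalise xs)   ≡⟨ cong (weightFrom i) (normalise-cong e) ⟩
  weightFrom i (normalise ys)   ≡⟨ weightFrom-normalise i ys ⟩
  weightFrom i ys               ∎
  where open ≡-Reasoning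

weightFrom-⊕ : ∀ i xs ys → weightFrom i (xs ⊕ ys) ≡ weightFrom i xs + weightFrom i ys
weightFrom-⊕ i []       ys       = refl
weightFrom-⊕ i (x ∷ xs) []       = sym (+-identityʳ _)
weightFrom-⊕ i (x ∷ xs) (y ∷ ys) = begin
  i * (x + y) + weightFrom (suc i) (xs ⊕ ys)
    ≡⟨ cong₂ _+_ (*-distribˡ-+ i x y) (weightFrom-⊕ (suc i) xs ys) ⟩
  (i * x + i * y) + (weightFrom (suc i) xs + weightFrom (suc i) ys)
    ≡⟨ +-interchange (i * x) (i * y) _ _ ⟩
  (i * x + weightFrom (suc i) xs) + (i * y + weightFrom (suc i) ys) ∎
  where open ≡-Reasoning

weightFrom-map-* : ∀ c i xs → weightFrom i (map (_* c) xs) ≡ weightFrom i xs * c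
weightFrom-map-* c i []       = refl
weightFrom-map-* c i (x ∷ xs) = begin
  i * (x * c) + weightFrom (suc i) (map (_* c) xs) ≡⟨ cong₂ _+_ (sym (*-assoc i x c)) (weightFrom-map-* c (suc i) xs) ⟩
  i * x * c + weightFrom (suc i) xs * c            ≡⟨ *-distribʳ-+ c (i * x) _ ⟨
  (i * x + weightFrom (suc i) xs) * c             ∎
  where open ≡-Reasoning

⊕-vanishingʳ : ∀ xs {zs} → Vanishing zs → xs ⊕ zs ≋ xs
⊕-vanishingʳ xs {zs} z = begin
  xs ⊕ zs   ≈⟨ ⊕-cong ≋-refl (vanishing-≋ z) ⟩
  xs ⊕ []   ≡⟨ ⊕-identityʳ xs ⟩
  xs        ∎
  where open ≋-Reasoning

⊕-vanishingˡ : ∀ {zs} → Vanishing zs → ∀ xs → zs ⊕ xs ≋ xs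
⊕-vanishingˡ {zs} z xs = coeffwise λ p →
  trans (coeff-⊕ zs xs p) (cong (_+ coeff xs p) (coeff-≡ (vanishing-≋ z) p))

zeros : List ℕ → List ℕ
zeros = map (λ _ → 0)

zeros-vanishing : ∀ xs → Vanishing (zeros xs)
zeros-vanishing []       = []
zeros-vanishing (_ ∷ xs) = refl ∷ zeros-vanishing xs

∷₀-⊕-0∷ : ∀ x ys zs → (x ∷₀ ys) ⊕ (0 ∷ zs) ≡ x ∷ (ys ⊕ zs)
∷₀-⊕-0∷ zero    []      zs = refl
∷₀-⊕-0∷ zero    (_ ∷ _) zs = refl
∷₀-⊕-0∷ (suc x) ys      zs = cong (_∷ ys ⊕ zs) (+-identityʳ (suc x))

normalise-⊕-zeros : ∀ xs → normalise xs ⊕ zeros xs ≡ xs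
normalise-⊕-zeros []       = refl
normalise-⊕-zeros (x ∷ xs) = trans (∷₀-⊕-0∷ x (normalise xs) (zeros xs)) (cong (x ∷_) (normalise-⊕-zeros xs))

module _ (f : List ℕ → List ℕ) (f-⊕ : ∀ xs ys → f (xs ⊕ ys) ≡ f xs ⊕ f ys)
         (f-vanishing : ∀ {zs} → Vanishing zs → Vanishing (f zs)) where

  additive-normalise : ∀ xs → f (normalise xs) ≋ f xs
  additive-normalise xs = begin
    f (normalise xs)                    ≈⟨ ⊕-vanishingʳ _ (f-vanishing (zeros-vanishing xs)) ⟨
    f (normalise xs) ⊕ f (zeros xs)     ≡⟨ f-⊕ (normalise xs) (zeros xs) ⟨
    f (normalise xs ⊕ zeros xs)         ≡⟨ cong f (normalise-⊕-zeros xs) ⟩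
    f xs                                ∎
    where open ≋-Reasoning

regAt⁺ : ∀ {a b i f} → (a ∣ i → f ≡ 0) → f < b → RegAt a b i f
regAt⁺ {a} {i = i} vanishes bounded with a ∣? i
... | yes a∣i = vanishes a∣i
... | no  _   = bounded

regAt-vanishes : ∀ {a b i f} → a ∣ i → RegAt a b i f → f ≡ 0
regAt-vanishes {a} {i = i} a∣i r with a ∣? i
... | yes _   = r
... | no  a∤i = ⊥-elim (a∤i a∣i)

regAt-bounded : ∀ {a b i f} → 0 < b → RegAt a b i f → f < b
regAt-bounded {a} {i = i} 0<b r with a ∣? i
... | yes _ = subst (_< _) (sym r) 0<b
... | no  _ = r

regAt-zero : ∀ {a b i} → 0 < b → RegAt a b i 0
regAt-zero {a} {i = i} 0<b = regAt⁺ {a} {i = i} (λ _ → refl) 0<b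

regAt-refine : ∀ {a b l i x} → 0 < l → RegAt a l i x → RegAt (a * b) l i x
regAt-refine {a} {b} {l} {i} 0<l r =
  regAt⁺ {a * b} {i = i} (λ ab∣i → regAt-vanishes {a} {l} (∣-trans (m∣m*n b) ab∣i) r)
                         (regAt-bounded {a} {l} {i} 0<l r)

regAt-coarsen : ∀ {a b l i x} → 0 < l → ¬ a ∣ i → RegAt (a * b) l i x → RegAt a l i x
regAt-coarsen {a} {b} {l} {i} 0<l a∤i r =
  regAt⁺ {a} {i = i} (λ a∣i → ⊥-elim (a∤i a∣i)) (regAt-bounded {a * b} {l} {i} 0<l r)

regAt-unscale : ∀ {a b l j x} → 0 < l → RegAt (a * b) l (a * j) x → RegAt b l j x
regAt-unscale {a} {b} {l} {j} 0<l r =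
  regAt⁺ {b} {i = j} (λ b∣j → regAt-vanishes {a * b} {l} (*-monoʳ-∣ a b∣j) r)
                     (regAt-bounded {a * b} {l} {a * j} 0<l r)

regAt-rescale : ∀ {a b l j x} .{{_ : NonZero a}} → 0 < l → RegAt b l j x → RegAt (a * b) l (a * j) x
regAt-rescale {a} {b} {l} {j} 0<l r =
  regAt⁺ {a * b} {i = a * j} (λ ab∣aj → regAt-vanishes {b} {l} (*-cancelˡ-∣ a ab∣aj) r)
                             (regAt-bounded {b} {l} {j} 0<l r)

RegAt-irrelevant : ∀ {a b i f} (r s : RegAt a b i f) → r ≡ s
RegAt-irrelevant {a} {i = i} r s with a ∣? i
... | yes _ = ≡-irrelevant r s
... | no  _ = <-irrelevant r s

RegFrom-irrelevant : ∀ {a b} i xs (r s : RegFrom a b i xs) → r ≡ s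
RegFrom-irrelevant i []       _       _       = refl
RegFrom-irrelevant {a} i (x ∷ xs) (r , rs) (s , ss) =
  cong₂ _,_ (RegAt-irrelevant {a} {i = i} r s) (RegFrom-irrelevant (suc i) xs rs ss)

NoTrailingZero-irrelevant : ∀ xs (c d : NoTrailingZero xs) → c ≡ d
NoTrailingZero-irrelevant []           _ _ = refl
NoTrailingZero-irrelevant (_ ∷ [])     c d = <-irrelevant c d
NoTrailingZero-irrelevant (_ ∷ y ∷ ys) c d = NoTrailingZero-irrelevant (y ∷ ys) c d

RegPart-≋⇒≡ : ∀ {a b} (P Q : RegPart a b) → proj₁ P ≋ proj₁ Q → P ≡ Q
RegPart-≋⇒≡ (xs , cx , rx) (ys , cy , ry) e
  with refl ← canonical-≋⇒≡ xs ys cx cy e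
  rewrite NoTrailingZero-irrelevant xs cx cy | RegFrom-irrelevant 1 xs rx ry = refl

Regular : ℕ → ℕ → List ℕ → Set
Regular a b xs = ∀ p → RegAt a b (1 + p) (coeff xs p)

RegFrom⇒RegAt : ∀ {a b} → 0 < b → ∀ i xs → RegFrom a b i xs → ∀ p → RegAt a b (i + p) (coeff xs p)
RegFrom⇒RegAt {a} {b} 0<b i []       _        p       = regAt-zero {a} {b} {i + p} 0<b
RegFrom⇒RegAt {a} {b} 0<b i (x ∷ xs) (r , _)  zero    = subst (λ j → RegAt a b j x) (sym (+-identityʳ i)) r
RegFrom⇒RegAt {a} {b} 0<b i (x ∷ xs) (_ , rs) (suc p) =
  subst (λ j → RegAt a b j (coeff xs p)) (sym (+-suc i p)) (RegFrom⇒RegAt 0<b (suc i) xs rs p)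

RegAt⇒RegFrom : ∀ {a b} i xs → (∀ p → RegAt a b (i + p) (coeff xs p)) → RegFrom a b i xs
RegAt⇒RegFrom {a} {b} i []       _ = tt
RegAt⇒RegFrom {a} {b} i (x ∷ xs) r =
  subst (λ j → RegAt a b j x) (+-identityʳ i) (r 0) ,
  RegAt⇒RegFrom (suc i) xs (λ p → subst (λ j → RegAt a b j (coeff xs p)) (+-suc i p) (r (suc p)))

RegPart-regular : ∀ {a b} → 0 < b → (P : RegPart a b) → Regular a b (proj₁ P)
RegPart-regular 0<b (xs , _ , r) = RegFrom⇒RegAt 0<b 1 xs r

Regular-≋ : ∀ {a b xs ys} → xs ≋ ys → Regular a b xs → Regular a b ys
Regular-≋ {a} {b} e r p = subst (RegAt a b (1 + p)) (coeff-≡ e p) (r p)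

RegFrom-≋ : ∀ {a b i xs ys} → 0 < b → xs ≋ ys → RegFrom a b i xs → RegFrom a b i ys
RegFrom-≋ {a} {b} {i} {xs} {ys} 0<b e r = RegAt⇒RegFrom i ys λ p →
  subst (RegAt a b (i + p)) (coeff-≡ e p) (RegFrom⇒RegAt 0<b i xs r p)

part : ∀ {a b} xs → Regular a b xs → RegPart a b
part {a} {b} xs r =
  normalise xs , normalise-canonical xs , RegAt⇒RegFrom 1 (normalise xs) (Regular-≋ {a} {b} (≋-sym (normalise-≋ xs)) r)

Regular-map : ∀ {a b b′ xs} g → g 0 ≡ 0 → (∀ f → f < b → g f < b′) → 0 < b →
              Regular a b xs → Regular a b′ (map g xs)
Regular-map {a} {b} {b′} {xs} g g0≡0 g-< 0<b r p =
  subst (RegAt a b′ (1 + p)) (sym (coeff-map g g0≡0 xs p))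
    (regAt⁺ {a} {i = 1 + p} (λ a∣i → trans (cong g (regAt-vanishes {a} {b} a∣i (r p))) g0≡0)
                            (g-< _ (regAt-bounded {a} {b} {1 + p} 0<b (r p))))

digits-< : ∀ {b c x y} → x < b → y < c → x + y * b < b * c
digits-< {b} {c} {x} {y} x<b y<c = begin-strict
  x + y * b   <⟨ +-monoˡ-< (y * b) x<b ⟩
  b + y * b   ≡⟨ *-comm (suc y) b ⟩
  b * suc y   ≤⟨ *-monoʳ-≤ b y<c ⟩
  b * c       ∎
  where open ≤-Reasoning

module MultiplicitySplit (a b c : ℕ) .{{_ : NonZero b}} (0<c : 0 < c) where

  0<b : 0 < b
  0<b = >-nonZero⁻¹ b

  0<b*c : 0 < b * c
  0<b*c = *-mono-< 0<b 0<c

  low high : List ℕ → List ℕ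
  low  = map (_% b)
  high = map (_/ b)

  combine : List ℕ → List ℕ → List ℕ
  combine xs ys = xs ⊕ map (_* b) ys

  coeff-combine : ∀ xs ys p → coeff (combine xs ys) p ≡ coeff xs p + coeff ys p * b
  coeff-combine xs ys p =
    trans (coeff-⊕ xs (map (_* b) ys) p) (cong (coeff xs p +_) (coeff-map (_* b) refl ys p))

  low-regular : ∀ xs → Regular a (b * c) xs → Regular a b (low xs)
  low-regular xs = Regular-map {a} {xs = xs} (_% b) (m<n⇒m%n≡m 0<b) (λ f _ → m%n<n f b) 0<b*c

  high-regular : ∀ xs → Regular a (b * c) xs → Regular a c (high xs)
  high-regular xs =
    Regular-map {a} {xs = xs} (_/ b) (0/n≡0 b) (λ f f<bc → m<n*o⇒m/o<n (subst (f <_) (*-comm b c) f<bc)) 0<b*c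

  combine-regular : ∀ xs ys → Regular a b xs → Regular a c ys → Regular a (b * c) (combine xs ys)
  combine-regular xs ys rx ry p = subst (RegAt a (b * c) (1 + p)) (sym (coeff-combine xs ys p))
    (regAt⁺ {a} {i = 1 + p}
      (λ a∣i → cong₂ (λ x y → x + y * b) (regAt-vanishes {a} {b} a∣i (rx p)) (regAt-vanishes {a} {c} a∣i (ry p)))
      (digits-< (regAt-bounded {a} {b} {1 + p} 0<b (rx p)) (regAt-bounded {a} {c} {1 + p} 0<c (ry p))))

  low-digit : ∀ {x y} → x < b → (x + y * b) % b ≡ x
  low-digit {x} {y} x<b = trans ([m+kn]%n≡m%n x y b) (m<n⇒m%n≡m x<b)

  high-digit : ∀ {x y} → x < b → (x + y * b) / b ≡ y
  high-digit {x} {y} x<b = begin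
    (x + y * b) / b     ≡⟨ +-distrib-/-∣ʳ x (divides y refl) ⟩
    x / b + y * b / b   ≡⟨ cong₂ _+_ (m<n⇒m/n≡0 x<b) (m*n/n≡m y b) ⟩
    y                   ∎
    where open ≡-Reasoning

  combine-low-high : ∀ xs → combine (low xs) (high xs) ≋ xs
  combine-low-high xs = coeffwise λ p → begin
    coeff (combine (low xs) (high xs)) p          ≡⟨ coeff-combine (low xs) (high xs) p ⟩
    coeff (low xs) p + coeff (high xs) p * b
      ≡⟨ cong₂ (λ x y → x + y * b) (coeff-map (_% b) (m<n⇒m%n≡m 0<b) xs p) (coeff-map (_/ b) (0/n≡0 b) xs p) ⟩
    coeff xs p % b + coeff xs p / b * b           ≡⟨ m≡m%n+[m/n]*n (coeff xs p) b ⟨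
    coeff xs p                                    ∎
    where open ≡-Reasoning

  low-combine : ∀ {xs ys} → Regular a b xs → low (combine xs ys) ≋ xs
  low-combine {xs} {ys} rx = coeffwise λ p → begin
    coeff (low (combine xs ys)) p     ≡⟨ coeff-map (_% b) (m<n⇒m%n≡m 0<b) (combine xs ys) p ⟩
    coeff (combine xs ys) p % b       ≡⟨ cong (_% b) (coeff-combine xs ys p) ⟩
    (coeff xs p + coeff ys p * b) % b ≡⟨ low-digit {y = coeff ys p} (regAt-bounded {a} {b} {1 + p} 0<b (rx p)) ⟩
    coeff xs p                        ∎
    where open ≡-Reasoning

  high-combine : ∀ {xs ys} → Regular a b xs → high (combine xs ys) ≋ ys
  high-combine {xs} {ys} rx = coeffwise λ p → begin
    coeff (high (combine xs ys)) p    ≡⟨ coeff-map (_/ b) (0/n≡0 b) (combine xs ys) p ⟩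
    coeff (combine xs ys) p / b       ≡⟨ cong (_/ b) (coeff-combine xs ys p) ⟩
    (coeff xs p + coeff ys p * b) / b ≡⟨ high-digit {y = coeff ys p} (regAt-bounded {a} {b} {1 + p} 0<b (rx p)) ⟩
    coeff ys p                        ∎
    where open ≡-Reasoning

  combine-cong : ∀ {xs xs′ ys ys′} → xs ≋ xs′ → ys ≋ ys′ → combine xs ys ≋ combine xs′ ys′
  combine-cong e e′ = ⊕-cong e (map-≋ (_* b) refl e′)

  to : RegPart a (b * c) → RegPart a b × RegPart a c
  to P = part (low xs) (low-regular xs r) , part (high xs) (high-regular xs r)
    where
    xs = proj₁ P
    r  = RegPart-regular 0<b*c P

  from : RegPart a b × RegPart a c → RegPart a (b * c)
  from (M , N) = part (combine (proj₁ M) (proj₁ N))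
    (combine-regular (proj₁ M) (proj₁ N) (RegPart-regular 0<b M) (RegPart-regular 0<c N))

  to∘from : ∀ MN → to (from MN) ≡ MN
  to∘from (M , N) = cong₂ _,_
    (RegPart-≋⇒≡ _ M (≋-trans (normalise-≋ _)
      (≋-trans (map-≋ (_% b) (m<n⇒m%n≡m 0<b) (normalise-≋ C)) (low-combine rM))))
    (RegPart-≋⇒≡ _ N (≋-trans (normalise-≋ _)
      (≋-trans (map-≋ (_/ b) (0/n≡0 b) (normalise-≋ C)) (high-combine rM))))
    where
    C  = combine (proj₁ M) (proj₁ N)
    rM = RegPart-regular 0<b M

  from∘to : ∀ P → from (to P) ≡ P
  from∘to P = RegPart-≋⇒≡ _ P
    (≋-trans (normalise-≋ _)
      (≋-trans (combine-cong (normalise-≋ (low xs)) (normalise-≋ (high xs))) (combine-low-high xs)))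
    where xs = proj₁ P

  bijection : RegPart a (b * c) ↔ (RegPart a b × RegPart a c)
  bijection = mk↔ₛ′ to from to∘from from∘to

  weight-to : ∀ P → weight (proj₁ P) ≡ weight (proj₁ (proj₁ (to P))) + b * weight (proj₁ (proj₂ (to P)))
  weight-to P = begin
    weight xs                                     ≡⟨ weightFrom-cong 1 (combine-low-high xs) ⟨
    weight (combine (low xs) (high xs))           ≡⟨ weightFrom-⊕ 1 (low xs) (map (_* b) (high xs)) ⟩
    weight (low xs) + weight (map (_* b) (high xs)) ≡⟨ cong (weight (low xs) +_) (weightFrom-map-* b 1 (high xs)) ⟩
    weight (low xs) + weight (high xs) * b        ≡⟨ cong (weight (low xs) +_) (*-comm (weight (high xs)) b) ⟩
    weight (low xs) + b * weight (high xs)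
      ≡⟨ cong₂ (λ u v → u + b * v) (weightFrom-normalise 1 (low xs)) (weightFrom-normalise 1 (high xs)) ⟨
    weight (normalise (low xs)) + b * weight (normalise (high xs)) ∎
    where
    open ≡-Reasoning
    xs = proj₁ P

-- The counter c is the number of entries before the next part divisible by k = 1 + k′; the lemmas
-- carry the invariant i + c ≡ k * j, where i is the current part and k * j that next multiple of k.
module PartSplit (k′ k₂ l : ℕ) (0<l : 0 < l) where

  k : ℕ
  k = suc k′

  zeroMultiples : ℕ → List ℕ → List ℕ
  zeroMultiples _       []       = []
  zeroMultiples zero    (x ∷ xs) = 0 ∷ zeroMultiples k′ xs
  zeroMultiples (suc c) (x ∷ xs) = x ∷ zeroMultiples c xs

  atMultiples : ℕ → List ℕ → List ℕ
  atMultiples _       []       = []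
  atMultiples zero    (x ∷ xs) = x ∷ atMultiples k′ xs
  atMultiples (suc c) (x ∷ xs) = atMultiples c xs

  spread : ℕ → List ℕ → List ℕ
  spread _       []       = []
  spread zero    (y ∷ ys) = y ∷ spread k′ ys
  spread (suc c) (y ∷ ys) = 0 ∷ spread c (y ∷ ys)

  zeroMultiples-⊕ : ∀ c xs ys → zeroMultiples c (xs ⊕ ys) ≡ zeroMultiples c xs ⊕ zeroMultiples c ys
  zeroMultiples-⊕ c       []       ys       = refl
  zeroMultiples-⊕ c       (x ∷ xs) []       = sym (⊕-identityʳ (zeroMultiples c (x ∷ xs)))
  zeroMultiples-⊕ zero    (x ∷ xs) (y ∷ ys) = cong (0 ∷_) (zeroMultiples-⊕ k′ xs ys)
  zeroMultiples-⊕ (suc c) (x ∷ xs) (y ∷ ys) = cong (x + y ∷_) (zeroMultiples-⊕ c xs ys)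

  atMultiples-⊕ : ∀ c xs ys → atMultiples c (xs ⊕ ys) ≡ atMultiples c xs ⊕ atMultiples c ys
  atMultiples-⊕ c       []       ys       = refl
  atMultiples-⊕ c       (x ∷ xs) []       = sym (⊕-identityʳ (atMultiples c (x ∷ xs)))
  atMultiples-⊕ zero    (x ∷ xs) (y ∷ ys) = cong (x + y ∷_) (atMultiples-⊕ k′ xs ys)
  atMultiples-⊕ (suc c) (x ∷ xs) (y ∷ ys) = atMultiples-⊕ c xs ys

  spread-⊕ : ∀ c xs ys → spread c (xs ⊕ ys) ≡ spread c xs ⊕ spread c ys
  spread-⊕ c       []       ys       = refl
  spread-⊕ c       (x ∷ xs) []       = sym (⊕-identityʳ (spread c (x ∷ xs)))
  spread-⊕ zero    (x ∷ xs) (y ∷ ys) = cong (x + y ∷_) (spread-⊕ k′ xs ys)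
  spread-⊕ (suc c) (x ∷ xs) (y ∷ ys) = cong (0 ∷_) (spread-⊕ c (x ∷ xs) (y ∷ ys))

  zeroMultiples-vanishing : ∀ c {zs} → Vanishing zs → Vanishing (zeroMultiples c zs)
  zeroMultiples-vanishing c       []         = []
  zeroMultiples-vanishing zero    (_ ∷ z)    = refl ∷ zeroMultiples-vanishing k′ z
  zeroMultiples-vanishing (suc c) (z≡0 ∷ z)  = z≡0 ∷ zeroMultiples-vanishing c z

  atMultiples-vanishing : ∀ c {zs} → Vanishing zs → Vanishing (atMultiples c zs)
  atMultiples-vanishing c       []         = []
  atMultiples-vanishing zero    (z≡0 ∷ z)  = z≡0 ∷ atMultiples-vanishing k′ z
  atMultiples-vanishing (suc c) (_ ∷ z)    = atMultiples-vanishing c z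

  spread-vanishing : ∀ c {zs} → Vanishing zs → Vanishing (spread c zs)
  spread-vanishing c       []         = []
  spread-vanishing zero    (z≡0 ∷ z)  = z≡0 ∷ spread-vanishing k′ z
  spread-vanishing (suc c) (z≡0 ∷ z)  = refl ∷ spread-vanishing c (z≡0 ∷ z)

  spread-suc : ∀ c ys → spread (suc c) ys ≋ 0 ∷ spread c ys
  spread-suc c []      = ∷₀-≋ 0 []
  spread-suc c (_ ∷ _) = ≋-refl

  zeroMultiples-⊕-spread-atMultiples : ∀ c xs → zeroMultiples c xs ⊕ spread c (atMultiples c xs) ≋ xs
  zeroMultiples-⊕-spread-atMultiples c       []       = ≋-refl
  zeroMultiples-⊕-spread-atMultiples zero    (x ∷ xs) = ∷-≋ refl (zeroMultiples-⊕-spread-atMultiples k′ xs)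
  zeroMultiples-⊕-spread-atMultiples (suc c) (x ∷ xs) =
    ≋-trans (⊕-cong ≋-refl (spread-suc c (atMultiples c xs)))
            (∷-≋ (+-identityʳ x) (zeroMultiples-⊕-spread-atMultiples c xs))

  zeroMultiples-spread : ∀ c ys → Vanishing (zeroMultiples c (spread c ys))
  zeroMultiples-spread c       []       = []
  zeroMultiples-spread zero    (y ∷ ys) = refl ∷ zeroMultiples-spread k′ ys
  zeroMultiples-spread (suc c) (y ∷ ys) = refl ∷ zeroMultiples-spread c (y ∷ ys)

  atMultiples-spread : ∀ c ys → atMultiples c (spread c ys) ≡ ys
  atMultiples-spread c       []       = refl
  atMultiples-spread zero    (y ∷ ys) = cong (y ∷_) (atMultiples-spread k′ ys)
  atMultiples-spread (suc c) (y ∷ ys) = atMultiples-spread c (y ∷ ys)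

  at-multiple : ∀ {i j} → i + 0 ≡ k * j → i ≡ k * j
  at-multiple {i} eq = trans (sym (+-identityʳ i)) eq

  after-multiple : ∀ j → suc (k * j) + k′ ≡ k * suc j
  after-multiple j = begin
    suc (k * j) + k′   ≡⟨ +-suc (k * j) k′ ⟨
    k * j + k          ≡⟨ +-comm (k * j) k ⟩
    k + k * j          ≡⟨ *-suc k j ⟨
    k * suc j          ∎
    where open ≡-Reasoning

  before-multiple : ∀ {i c j} → i + suc c ≡ k * j → suc i + c ≡ k * j
  before-multiple {i} {c} eq = trans (sym (+-suc i c)) eq

  not-multiple : ∀ {i c j} → i + suc c ≡ k * j → suc c ≤ k′ → ¬ k ∣ i
  not-multiple {i} {c} {j} eq c<k′ k∣i =
    <⇒≱ (s≤s c<k′) (∣⇒≤ (∣m+n∣m⇒∣n (subst (k ∣_) (sym eq) (m∣m*n j)) k∣i))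

  split-regular : ∀ c i j xs → i + c ≡ k * j → c ≤ k′ → RegFrom (k * k₂) l i xs →
                  RegFrom k l i (zeroMultiples c xs) × RegFrom k₂ l j (atMultiples c xs)
  split-regular c i j [] _ _ _ = tt , tt
  split-regular zero i j (x ∷ xs) eq _ (r , rs) with refl ← at-multiple eq =
    let rz , ra = split-regular k′ (suc (k * j)) (suc j) xs (after-multiple j) ≤-refl rs
    in (regAt-zero {k} {l} {k * j} 0<l , rz) , (regAt-unscale {k} {k₂} {l} {j} 0<l r , ra)
  split-regular (suc c) i j (x ∷ xs) eq c<k′ (r , rs) =
    let rz , ra = split-regular c (suc i) j xs (before-multiple eq) (≤-trans (n≤1+n c) c<k′) rs
    in (regAt-coarsen {k} {k₂} {l} {i} 0<l (not-multiple eq c<k′) r , rz) , ra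

  merge-regular : ∀ c i j xs → i + c ≡ k * j →
                  RegFrom k l i (zeroMultiples c xs) → RegFrom k₂ l j (atMultiples c xs) → RegFrom (k * k₂) l i xs
  merge-regular c i j [] _ _ _ = tt
  merge-regular zero i j (x ∷ xs) eq (_ , rz) (ra , ras) with refl ← at-multiple eq =
    regAt-rescale {k} {k₂} {l} {j} 0<l ra , merge-regular k′ (suc (k * j)) (suc j) xs (after-multiple j) rz ras
  merge-regular (suc c) i j (x ∷ xs) eq (r , rz) ra =
    regAt-refine {k} {k₂} {l} {i} 0<l r , merge-regular c (suc i) j xs (before-multiple eq) rz ra

  zeroMultiples-regular : ∀ c i j xs → i + c ≡ k * j → RegFrom k l i xs → zeroMultiples c xs ≡ xs
  zeroMultiples-regular c i j [] _ _ = refl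
  zeroMultiples-regular zero i j (x ∷ xs) eq (r , rs) with refl ← at-multiple eq =
    cong₂ _∷_ (sym (regAt-vanishes {k} {l} (m∣m*n j) r))
              (zeroMultiples-regular k′ (suc (k * j)) (suc j) xs (after-multiple j) rs)
  zeroMultiples-regular (suc c) i j (x ∷ xs) eq (_ , rs) =
    cong (x ∷_) (zeroMultiples-regular c (suc i) j xs (before-multiple eq) rs)

  atMultiples-regular : ∀ c i j xs → i + c ≡ k * j → RegFrom k l i xs → Vanishing (atMultiples c xs)
  atMultiples-regular c i j [] _ _ = []
  atMultiples-regular zero i j (x ∷ xs) eq (r , rs) with refl ← at-multiple eq =
    regAt-vanishes {k} {l} (m∣m*n j) r ∷ atMultiples-regular k′ (suc (k * j)) (suc j) xs (after-multiple j) rs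
  atMultiples-regular (suc c) i j (x ∷ xs) eq (_ , rs) =
    atMultiples-regular c (suc i) j xs (before-multiple eq) rs

  weightFrom-spread : ∀ c i j ys → i + c ≡ k * j → weightFrom i (spread c ys) ≡ k * weightFrom j ys
  weightFrom-spread c i j [] _ = sym (*-zeroʳ k)
  weightFrom-spread zero i j (y ∷ ys) eq with refl ← at-multiple eq = begin
    k * j * y + weightFrom (suc (k * j)) (spread k′ ys)
      ≡⟨ cong₂ _+_ (*-assoc k j y) (weightFrom-spread k′ _ _ ys (after-multiple j)) ⟩
    k * (j * y) + k * weightFrom (suc j) ys              ≡⟨ *-distribˡ-+ k (j * y) _ ⟨
    k * (j * y + weightFrom (suc j) ys)                  ∎
    where open ≡-Reasoning
  weightFrom-spread (suc c) i j (y ∷ ys) eq =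
    trans (cong (_+ weightFrom (suc i) (spread c (y ∷ ys))) (*-zeroʳ i))
          (weightFrom-spread c (suc i) j (y ∷ ys) (before-multiple eq))

  first-multiple : 1 + k′ ≡ k * 1
  first-multiple = sym (*-identityʳ k)

  merge : List ℕ → List ℕ → List ℕ
  merge xs ys = xs ⊕ spread k′ ys

  zeroMultiples-merge : ∀ {xs} ys → RegFrom k l 1 xs → zeroMultiples k′ (merge xs ys) ≋ xs
  zeroMultiples-merge {xs} ys r = begin
    zeroMultiples k′ (xs ⊕ spread k′ ys)
      ≡⟨ zeroMultiples-⊕ k′ xs (spread k′ ys) ⟩
    zeroMultiples k′ xs ⊕ zeroMultiples k′ (spread k′ ys)
      ≈⟨ ⊕-vanishingʳ _ (zeroMultiples-spread k′ ys) ⟩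
    zeroMultiples k′ xs
      ≡⟨ zeroMultiples-regular k′ 1 1 xs first-multiple r ⟩
    xs ∎
    where open ≋-Reasoning

  atMultiples-merge : ∀ {xs} ys → RegFrom k l 1 xs → atMultiples k′ (merge xs ys) ≋ ys
  atMultiples-merge {xs} ys r = begin
    atMultiples k′ (xs ⊕ spread k′ ys)
      ≡⟨ atMultiples-⊕ k′ xs (spread k′ ys) ⟩
    atMultiples k′ xs ⊕ atMultiples k′ (spread k′ ys)
      ≡⟨ cong (atMultiples k′ xs ⊕_) (atMultiples-spread k′ ys) ⟩
    atMultiples k′ xs ⊕ ys
      ≈⟨ ⊕-vanishingˡ (atMultiples-regular k′ 1 1 xs first-multiple r) ys ⟩
    ys ∎
    where open ≋-Reasoning

  to : RegPart (k * k₂) l → RegPart k l × RegPart k₂ l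
  to (xs , _ , r) =
    part (zeroMultiples k′ xs) (RegFrom⇒RegAt 0<l 1 _ rz) , part (atMultiples k′ xs) (RegFrom⇒RegAt 0<l 1 _ ra)
    where
    rz×ra = split-regular k′ 1 1 xs first-multiple ≤-refl r
    rz = proj₁ rz×ra
    ra = proj₂ rz×ra

  from : RegPart k l × RegPart k₂ l → RegPart (k * k₂) l
  from ((xs , _ , rx) , (ys , _ , ry)) = part (merge xs ys) (RegFrom⇒RegAt 0<l 1 _
    (merge-regular k′ 1 1 (merge xs ys) first-multiple
      (RegFrom-≋ 0<l (≋-sym (zeroMultiples-merge ys rx)) rx)
      (RegFrom-≋ 0<l (≋-sym (atMultiples-merge ys rx)) ry)))

  zeroMultiples-normalise : ∀ xs → zeroMultiples k′ (normalise xs) ≋ zeroMultiples k′ xs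
  zeroMultiples-normalise = additive-normalise (zeroMultiples k′) (zeroMultiples-⊕ k′) (zeroMultiples-vanishing k′)

  atMultiples-normalise : ∀ xs → atMultiples k′ (normalise xs) ≋ atMultiples k′ xs
  atMultiples-normalise = additive-normalise (atMultiples k′) (atMultiples-⊕ k′) (atMultiples-vanishing k′)

  spread-normalise : ∀ ys → spread k′ (normalise ys) ≋ spread k′ ys
  spread-normalise = additive-normalise (spread k′) (spread-⊕ k′) (spread-vanishing k′)

  to∘from : ∀ MN → to (from MN) ≡ MN
  to∘from (M@(xs , _ , rx) , N@(ys , _ , _)) = cong₂ _,_
    (RegPart-≋⇒≡ _ M (≋-trans (normalise-≋ _)
      (≋-trans (zeroMultiples-normalise (merge xs ys)) (zeroMultiples-merge ys rx))))
    (RegPart-≋⇒≡ _ N (≋-trans (normalise-≋ _)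
      (≋-trans (atMultiples-normalise (merge xs ys)) (atMultiples-merge ys rx))))

  from∘to : ∀ P → from (to P) ≡ P
  from∘to P@(xs , _ , _) = RegPart-≋⇒≡ _ P (≋-trans (normalise-≋ _)
    (≋-trans (⊕-cong (normalise-≋ _) (spread-normalise (atMultiples k′ xs)))
             (zeroMultiples-⊕-spread-atMultiples k′ xs)))

  bijection : RegPart (k * k₂) l ↔ (RegPart k l × RegPart k₂ l)
  bijection = mk↔ₛ′ to from to∘from from∘to

  weight-to : ∀ P → weight (proj₁ P) ≡ weight (proj₁ (proj₁ (to P))) + k * weight (proj₁ (proj₂ (to P)))
  weight-to (xs , _ , _) = begin
    weight xs
      ≡⟨ weightFrom-cong 1 (zeroMultiples-⊕-spread-atMultiples k′ xs) ⟨
    weight (zeroMultiples k′ xs ⊕ spread k′ (atMultiples k′ xs))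
      ≡⟨ weightFrom-⊕ 1 (zeroMultiples k′ xs) _ ⟩
    weight (zeroMultiples k′ xs) + weight (spread k′ (atMultiples k′ xs))
      ≡⟨ cong (weight (zeroMultiples k′ xs) +_) (weightFrom-spread k′ 1 1 (atMultiples k′ xs) first-multiple) ⟩
    weight (zeroMultiples k′ xs) + k * weight (atMultiples k′ xs)
      ≡⟨ cong₂ (λ u v → u + k * v)
           (weightFrom-normalise 1 (zeroMultiples k′ xs)) (weightFrom-normalise 1 (atMultiples k′ xs)) ⟨
    weight (normalise (zeroMultiples k′ xs)) + k * weight (normalise (atMultiples k′ xs)) ∎
    where open ≡-Reasoning

∅ : ∀ {a b} → RegPart a b
∅ = [] , tt , tt

RegPart-trivial : ∀ {a b} → 0 < b → (∀ i {f} → RegAt a b i f → f ≡ 0) → (P : RegPart a b) → P ≡ ∅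
RegPart-trivial 0<b forced P@(xs , _ , r) =
  RegPart-≋⇒≡ P ∅ (coeffwise λ p → forced (1 + p) (RegFrom⇒RegAt 0<b 1 xs r p))

regAt-unit-bound : ∀ {a} i {f} → RegAt a 1 i f → f ≡ 0
regAt-unit-bound {a} i r = n<1⇒n≡0 (regAt-bounded {a} {1} {i} (s≤s z≤n) r)

regAt-unit-modulus : ∀ {b} i {f} → RegAt 1 b i f → f ≡ 0
regAt-unit-modulus {b} i r = regAt-vanishes {1} {b} (1∣ i) r

trivial-↔ : ∀ {a b} {P : ℕ → Set} → 0 < b → (∀ i {f} → RegAt a b i f → f ≡ 0) → RegPart a b ↔ All P []
trivial-↔ 0<b forced = mk↔ₛ′ (λ _ → []) (λ _ → ∅) (λ { [] → refl }) (λ P → sym (RegPart-trivial 0<b forced P))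

∷-↔ : ∀ {A B C : Set} {P : ℕ → Set} {x xs} → A ↔ (C × B) → C ↔ P x → B ↔ All P xs → A ↔ All P (x ∷ xs)
∷-↔ {A} {B} {C} {P} {x} {xs} S U T = mk↔ₛ′ to from to∘from from∘to
  where
  to : A → All P (x ∷ xs)
  to a = Inverse.to U (proj₁ (Inverse.to S a)) ∷ Inverse.to T (proj₂ (Inverse.to S a))
  from : All P (x ∷ xs) → A
  from (p ∷ ps) = Inverse.from S (Inverse.from U p , Inverse.from T ps)
  to∘from : ∀ ps → to (from ps) ≡ ps
  to∘from (p ∷ ps) rewrite Inverse.strictlyInverseˡ S (Inverse.from U p , Inverse.from T ps) =
    cong₂ _∷_ (Inverse.strictlyInverseˡ U p) (Inverse.strictlyInverseˡ T ps)
  from∘to : ∀ a → from (to a) ≡ a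
  from∘to a
    rewrite Inverse.strictlyInverseʳ U (proj₁ (Inverse.to S a)) | Inverse.strictlyInverseʳ T (proj₂ (Inverse.to S a)) =
    Inverse.strictlyInverseʳ S a

product-positive : ∀ {ns} → All (0 <_) ns → 0 < product ns
product-positive 0<ns = >-nonZero⁻¹ _ {{product≢0 (All.map >-nonZero 0<ns)}}

rowBijection : ∀ a ls → All (0 <_) ls → RegPart a (product ls) ↔ All (λ b → RegPart a b) ls
rowBijection a []       []           = trivial-↔ (s≤s z≤n) (regAt-unit-bound {a})
rowBijection a (b ∷ ls) (0<b ∷ 0<ls) =
  ∷-↔ (MultiplicitySplit.bijection a b (product ls) {{>-nonZero 0<b}} (product-positive 0<ls))
      ↔-refl (rowBijection a ls 0<ls)

gridBijection : ∀ ks ls → All (0 <_) ks → All (0 <_) ls → RegPart (product ks) (product ls) ↔ Grid ks ls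
gridBijection []            ls []               0<ls =
  trivial-↔ (product-positive 0<ls) regAt-unit-modulus
gridBijection (suc k′ ∷ ks) ls (s≤s z≤n ∷ 0<ks) 0<ls =
  ∷-↔ (PartSplit.bijection k′ (product ks) (product ls) (product-positive 0<ls))
      (rowBijection (suc k′) ls 0<ls) (gridBijection ks ls 0<ks 0<ls)

rowBijection-weight : ∀ K L a ls (0<ls : All (0 <_) ls) (P : RegPart a (product ls)) →
                      K * L * weight (proj₁ P) ≡ rowWeight K L ls (Inverse.to (rowBijection a ls 0<ls) P)
rowBijection-weight K L a [] [] P
  rewrite RegPart-trivial (s≤s z≤n) (regAt-unit-bound {a}) P = *-zeroʳ (K * L)
rowBijection-weight K L a (b ∷ ls) (0<b ∷ 0<ls) P = begin
  K * L * weight (proj₁ P)                            ≡⟨ cong (K * L *_) (MS.weight-to P) ⟩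
  K * L * (weight (proj₁ μ) + b * weight (proj₁ ν))   ≡⟨ *-distribˡ-+ (K * L) _ _ ⟩
  K * L * weight (proj₁ μ) + K * L * (b * weight (proj₁ ν))
    ≡⟨ cong (K * L * weight (proj₁ μ) +_)
         (trans (sym (*-assoc (K * L) b _)) (cong (_* weight (proj₁ ν)) (*-assoc K L b))) ⟩
  K * L * weight (proj₁ μ) + K * (L * b) * weight (proj₁ ν)
    ≡⟨ cong (K * L * weight (proj₁ μ) +_) (rowBijection-weight K (L * b) a ls 0<ls ν) ⟩
  rowWeight K L (b ∷ ls) (μ ∷ Inverse.to (rowBijection a ls 0<ls) ν) ∎
  where
  open ≡-Reasoning
  module MS = MultiplicitySplit a b (product ls) {{>-nonZero 0<b}} (product-positive 0<ls)
  μ = proj₁ (MS.to P)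
  ν = proj₂ (MS.to P)

gridBijection-weight : ∀ K ks ls (0<ks : All (0 <_) ks) (0<ls : All (0 <_) ls)
                       (P : RegPart (product ks) (product ls)) →
                       K * weight (proj₁ P) ≡ gridWeightFrom K ks ls (Inverse.to (gridBijection ks ls 0<ks 0<ls) P)
gridBijection-weight K [] ls [] 0<ls P
  rewrite RegPart-trivial (product-positive 0<ls) regAt-unit-modulus P = *-zeroʳ K
gridBijection-weight K (suc k′ ∷ ks) ls (s≤s z≤n ∷ 0<ks) 0<ls P = begin
  K * weight (proj₁ P)                                ≡⟨ cong (K *_) (PS.weight-to P) ⟩
  K * (weight (proj₁ μ) + a * weight (proj₁ ν))       ≡⟨ *-distribˡ-+ K _ _ ⟩
  K * weight (proj₁ μ) + K * (a * weight (proj₁ ν))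
    ≡⟨ cong₂ _+_ (cong (_* weight (proj₁ μ)) (*-identityʳ K)) (*-assoc K a _) ⟨
  K * 1 * weight (proj₁ μ) + K * a * weight (proj₁ ν)
    ≡⟨ cong₂ _+_ (rowBijection-weight K 1 a ls 0<ls μ) (gridBijection-weight (K * a) ks ls 0<ks 0<ls ν) ⟩
  gridWeightFrom K (a ∷ ks) ls (Inverse.to (gridBijection (a ∷ ks) ls (s≤s z≤n ∷ 0<ks) 0<ls) P) ∎
  where
  open ≡-Reasoning
  a = suc k′
  module PS = PartSplit k′ (product ks) (product ls) (product-positive 0<ls)
  μ = proj₁ (PS.to P)
  ν = proj₂ (PS.to P)

mainTheorem4 : (k l : ℕ) → 0 < k → 0 < l →
    (ks ls : List ℕ) → All (0 <_) ks → All (0 <_) ls →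
    product ks ≡ k → product ls ≡ l →
    All (λ a → All (λ b → a ≡ b ⊎ gcd a b ≡ 1) ls) ks →
    Σ (RegPart k l ⤖ Grid ks ls) (λ Ψ →
      (p : RegPart k l) →
        weight (proj₁ p) ≡ gridWeight ks ls (Bijection.to Ψ p))
mainTheorem4 _ _ _ _ ks ls 0<ks 0<ls refl refl _ =
  ↔⇒⤖ (gridBijection ks ls 0<ks 0<ls) ,
  λ P → trans (sym (*-identityˡ _)) (gridBijection-weight 1 ks ls 0<ks 0<ls P)
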